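{- Let $n$ be a positive integer with legal decomposition $n=\delta_1a_1+\delta_2a_2+\cdots+\delta_ka_k$. Define $c_1=0$, $c_2=1$ and $c_i=(i-1)c_{i-1}+c_{i-2}+1$ for $i\ge 3$ (so $c_i$ is $0,1,3,11,48,252,\dots$). Then the number of combining moves in a complete generalized Zeckendorf game on $n$ equals $\delta_2c_2+\delta_3c_3+\cdots+\delta_kc_k$.
   Context: Let $a_1=1$, $a_2=2$ and $a_{i+1}=i\,a_i+a_{i-1}$ for $i\ge 2$. A legal decomposition of $n$ is $n=\sum_i \delta_i a_i$ with $\delta_i\in\{0,\dots,i\}$ and, if $\delta_i=i$, then $\delta_{i-1}=0$; it exists and is unique. The generalized Zeckendorf game on $n$: the state is a multiset of terms of the sequence, initially $n$ copies of $a_1=1$. A move is one of: (combining) replace two $1$'s by one $2$; or, for $i\ge 2$, if the multiset contains at least $i$ copies of $a_i$ and at least one $a_{i-1}$, replace $i$ copies of $a_i$ and one $a_{i-1}$ by one $a_{i+1}$; (splitting) if it contains three $2$'s, replace them by one $1$ and one $5$; or, for $i\ge 3$, if it contains $i+1$ copies of $a_i$, replace them by one $a_{i+1}$, $i-2$ copies of $a_{i-1}$ and one $a_{i-2}$. The game ends when no move is available. A complete game is a sequence of legal moves from the initial state to a state with no available move. -}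

module Defs where

open import Data.Nat using (ℕ; zero; suc; _+_; _*_; _∸_; _≤_; _≡ᵇ_)
open import Data.Bool using (if_then_else_)
open import Data.Product using (_×_)
open import Relation.Binary.PropositionalEquality using (_≡_)
open import Relation.Nullary using (¬_)

-- The sequence a_i (index 0 unused, set to 0):
-- a_1 = 1, a_2 = 2, a_{i+1} = i a_i + a_{i-1} for i ≥ 2.
a : ℕ → ℕ
a 0 = 0
a 1 = 1
a 2 = 2
a (suc (suc (suc j))) = suc (suc j) * a (suc (suc j)) + a (suc j)

c : ℕ → ℕ
c 0 = 0
c 1 = 0
c 2 = 1
c (suc (suc (suc j))) = suc (suc j) * c (suc (suc j)) + c (suc j) + 1

sum1to : ℕ → (ℕ → ℕ) → ℕ
sum1to zero f = 0
sum1to (suc k) f = sum1to k f + f (suc k)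

Legal : ℕ → ℕ → (ℕ → ℕ) → Set
Legal n k δ =
  (∀ i → 1 ≤ i → i ≤ k → δ i ≤ i) ×
  (∀ i → 2 ≤ i → i ≤ k → δ i ≡ i → δ (i ∸ 1) ≡ 0) ×
  (n ≡ sum1to k (λ i → δ i * a i))

-- A game state: a multiset of terms of the sequence, given by
-- s i = number of copies of a_i (i ≥ 1; index 0 is unused).
State : Set
State = ℕ → ℕ

pt : ℕ → ℕ → State
pt i k j = if i ≡ᵇ j then k else 0

initial : ℕ → State
initial n = pt 1 n

data MoveKind : Set where
  combining splitting : MoveKind

data Move (s : State) : Set where
  -- two 1's → one 2
  comb1  : 2 ≤ s 1 → Move s
  -- i copies of a_i and one a_{i-1} → one a_{i+1}   (i ≥ 2)
  combi  : (i : ℕ) → 2 ≤ i → i ≤ s i → 1 ≤ s (i ∸ 1) → Move s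
  -- three 2's → one 1 and one 5
  split2 : 3 ≤ s 2 → Move s
  -- i+1 copies of a_i → one a_{i+1}, i-2 copies of a_{i-1}, one a_{i-2}   (i ≥ 3)
  spliti : (i : ℕ) → 3 ≤ i → suc i ≤ s i → Move s

kind : {s : State} → Move s → MoveKind
kind (comb1 _) = combining
kind (combi _ _ _ _) = combining
kind (split2 _) = splitting
kind (spliti _ _ _) = splitting

-- Resulting state: remove `rem`, add `add` (preconditions guarantee rem ≤ s).
apply : (s : State) → Move s → State
apply s (comb1 _) j = s j ∸ pt 1 2 j + pt 2 1 j
apply s (combi i _ _ _) j =
  s j ∸ (pt i i j + pt (i ∸ 1) 1 j) + pt (suc i) 1 j
apply s (split2 _) j = s j ∸ pt 2 3 j + (pt 1 1 j + pt 3 1 j)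
apply s (spliti i _ _) j =
  s j ∸ pt i (suc i) j + (pt (suc i) 1 j + pt (i ∸ 1) (i ∸ 2) j + pt (i ∸ 2) 1 j)

data Game : State → Set where
  done : (s : State) → ¬ Move s → Game s
  step : (s : State) (m : Move s) → Game (apply s m) → Game s

combiningMoves : {s : State} → Game s → ℕ
combiningMoves (done _ _) = 0
combiningMoves (step _ m g) with kind m
... | combining = suc (combiningMoves g)
... | splitting = combiningMoves g

{-# OPTIONS --safe #-}
-- The value Σ sᵢaᵢ and the quantity Σ sᵢcᵢ of a state are both weights Σ sᵢwᵢ with
-- w₂ = 2w₁ + e and wᵢ₊₁ = i·wᵢ + wᵢ₋₁ + e (e = 0 for a, e = 1 for c), and every combining
-- move raises such a weight by e while every splitting move preserves it. So the final state
-- of a complete game still has value n, and its c-weight counts the combining moves. A state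
-- admitting no move is a legal decomposition, hence by uniqueness it is the decomposition δ
-- of n, whose c-weight is Σ δᵢcᵢ.
module Submission where

open import Defs
open import Data.Nat using (ℕ; zero; suc; _+_; _*_; _∸_; _≤_; _<_; _≤?_; _≟_; z≤n; s≤s; z<s; s≤s⁻¹; >-nonZero)
open import Data.Nat.Properties
open import Data.Nat.Tactic.RingSolver using (solve-∀)
open import Algebra.Properties.CommutativeSemigroup +-commutativeSemigroup
  using (x∙yz≈xz∙y) renaming (interchange to +-interchange)
open import Data.Product using (_,_)
open import Function using (_∘_)
open import Data.Sum using (inj₁; inj₂)
open import Relation.Nullary using (¬_; yes; no; contradiction)
open import Relation.Binary using (tri<; tri≈; tri>)
open import Relation.Binary.PropositionalEquality

pt-self : ∀ p q → pt p q p ≡ q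
pt-self zero    q = refl
pt-self (suc p) q = pt-self p q

pt-≢ : ∀ {p j} q → p ≢ j → pt p q j ≡ 0
pt-≢ {zero}  {zero}  q p≢j = contradiction refl p≢j
pt-≢ {zero}  {suc j} q _   = refl
pt-≢ {suc p} {zero}  q _   = refl
pt-≢ {suc p} {suc j} q p≢j = pt-≢ q (p≢j ∘ cong suc)

pt-> : ∀ {p j} q → p < j → pt p q j ≡ 0
pt-> q p<j = pt-≢ q (<⇒≢ p<j)

pt-≤ : ∀ {s : State} p {q} j → q ≤ s p → pt p q j ≤ s j
pt-≤ {s} p {q} j q≤sp with p ≟ j
... | yes refl = subst (_≤ s p) (sym (pt-self p q)) q≤sp
... | no p≢j   = subst (_≤ s j) (sym (pt-≢ q p≢j)) z≤n

pt-+-pt-≤ : ∀ {s : State} p p′ {q q′} j → p ≢ p′ → q ≤ s p → q′ ≤ s p′ →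
  pt p q j + pt p′ q′ j ≤ s j
pt-+-pt-≤ {s} p p′ {q} {q′} j p≢p′ q≤sp q′≤sp′ with p ≟ j
... | yes refl =
  subst (_≤ s p) (sym (trans (cong₂ _+_ (pt-self p q) (pt-≢ q′ (p≢p′ ∘ sym))) (+-identityʳ q))) q≤sp
... | no p≢j   = subst (_≤ s j) (sym (cong (_+ pt p′ q′ j) (pt-≢ q p≢j))) (pt-≤ p′ j q′≤sp′)

weight : ℕ → (ℕ → ℕ) → State → ℕ
weight M w s = sum1to M (λ i → s i * w i)

weight-cong : ∀ M w {s t : State} → (∀ j → s j ≡ t j) → weight M w s ≡ weight M w t
weight-cong zero    w s≗t = refl
weight-cong (suc M) w s≗t =
  cong₂ _+_ (weight-cong M w s≗t) (cong (_* w (suc M)) (s≗t (suc M)))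

weight-+ : ∀ M w (s t : State) → weight M w (λ j → s j + t j) ≡ weight M w s + weight M w t
weight-+ zero    w s t = refl
weight-+ (suc M) w s t = begin
  weight M w (λ j → s j + t j) + (s (suc M) + t (suc M)) * w (suc M)
    ≡⟨ cong₂ _+_ (weight-+ M w s t) (*-distribʳ-+ (w (suc M)) (s (suc M)) (t (suc M))) ⟩
  (weight M w s + weight M w t) + (s (suc M) * w (suc M) + t (suc M) * w (suc M))
    ≡⟨ +-interchange (weight M w s) (weight M w t) (s (suc M) * w (suc M)) (t (suc M) * w (suc M)) ⟩
  weight (suc M) w s + weight (suc M) w t ∎
  where open ≡-Reasoning

weight-pt-> : ∀ {M p} w q → M < p → weight M w (pt p q) ≡ 0
weight-pt-> {zero}  w q _   = refl
weight-pt-> {suc M} w q M<p =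
  cong₂ _+_ (weight-pt-> w q (<-trans (n<1+n M) M<p)) (cong (_* w (suc M)) (pt-≢ q (>⇒≢ M<p)))

weight-pt : ∀ {M} p w q → suc p ≤ M → weight M w (pt (suc p) q) ≡ q * w (suc p)
weight-pt {suc M} p w q p<1+M with suc p ≟ suc M
... | yes refl = cong₂ _+_ (weight-pt-> w q (n<1+n M)) (cong (_* w (suc M)) (pt-self (suc M) q))
... | no p≢M   = trans
  (cong₂ _+_ (weight-pt p w q (s≤s⁻¹ (≤∧≢⇒< p<1+M p≢M))) (cong (_* w (suc M)) (pt-≢ q p≢M)))
  (+-identityʳ _)

weight-pt-1 : ∀ {M} p w → suc p ≤ M → weight M w (pt (suc p) 1) ≡ w (suc p)
weight-pt-1 p w p<M = trans (weight-pt p w 1 p<M) (*-identityˡ _)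

Bounded : ℕ → State → Set
Bounded B s = ∀ j → B < j → s j ≡ 0

occupied-≤ : ∀ {B s p} → Bounded B s → 1 ≤ s p → p ≤ B
occupied-≤ {B} {s} {p} bounded 1≤sp with p ≤? B
... | yes p≤B = p≤B
... | no p≰B  = contradiction (bounded p (≰⇒> p≰B)) (>⇒≢ 1≤sp)

pivot : {s : State} → Move s → ℕ
pivot (comb1 _)       = 1
pivot (combi i _ _ _) = i
pivot (split2 _)      = 2
pivot (spliti i _ _)  = i

removed added : {s : State} → Move s → State
removed (comb1 _)       = pt 1 2
removed (combi i _ _ _) j = pt i i j + pt (i ∸ 1) 1 j
removed (split2 _)      = pt 2 3
removed (spliti i _ _)  = pt i (suc i)
added (comb1 _)       = pt 2 1
added (combi i _ _ _) = pt (suc i) 1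
added (split2 _)      j = pt 1 1 j + pt 3 1 j
added (spliti i _ _)  j = pt (suc i) 1 j + pt (i ∸ 1) (i ∸ 2) j + pt (i ∸ 2) 1 j

apply-≡ : ∀ {s} (m : Move s) j → apply s m j ≡ s j ∸ removed m j + added m j
apply-≡ (comb1 _)       j = refl
apply-≡ (combi _ _ _ _) j = refl
apply-≡ (split2 _)      j = refl
apply-≡ (spliti _ _ _)  j = refl

pivot-occupied : ∀ {s} (m : Move s) → 1 ≤ s (pivot m)
pivot-occupied (comb1 2≤s₁)         = <⇒≤ 2≤s₁
pivot-occupied (combi i 2≤i i≤sᵢ _) = ≤-trans (<⇒≤ 2≤i) i≤sᵢ
pivot-occupied (split2 3≤s₂)        = ≤-trans (s≤s z≤n) 3≤s₂
pivot-occupied (spliti i _ i<sᵢ)    = ≤-trans (s≤s z≤n) i<sᵢ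

removed-≤ : ∀ {s} (m : Move s) j → removed m j ≤ s j
removed-≤ {s} (comb1 2≤s₁)          j = pt-≤ {s} 1 j 2≤s₁
removed-≤ (combi i 2≤i i≤sᵢ 1≤sᵢ₋₁) j =
  pt-+-pt-≤ i (i ∸ 1) j (>⇒≢ (∸-monoʳ-< z<s (<⇒≤ 2≤i))) i≤sᵢ 1≤sᵢ₋₁
removed-≤ {s} (split2 3≤s₂)         j = pt-≤ {s} 2 j 3≤s₂
removed-≤ (spliti i _ i<sᵢ)         j = pt-≤ i j i<sᵢ

added-vanishes : ∀ {s} (m : Move s) j → suc (pivot m) < j → added m j ≡ 0
added-vanishes (comb1 _)       j 2<j = pt-> 1 2<j
added-vanishes (combi _ _ _ _) j i<j = pt-> 1 i<j
added-vanishes (split2 _)      j 3<j = cong₂ _+_ (pt-> 1 (<-trans (s≤s (s≤s z≤n)) 3<j)) (pt-> 1 3<j)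
added-vanishes (spliti i _ _)  j i<j = cong₂ _+_
  (cong₂ _+_ (pt-> 1 i<j) (pt-> (i ∸ 2) (≤-<-trans (≤-trans (m∸n≤m i 1) (n≤1+n i)) i<j)))
  (pt-> 1 (≤-<-trans (≤-trans (m∸n≤m i 2) (n≤1+n i)) i<j))

apply-+-removed : ∀ {s} (m : Move s) j → apply s m j + removed m j ≡ s j + added m j
apply-+-removed {s} m j = begin
  apply s m j + removed m j
    ≡⟨ cong (_+ removed m j) (apply-≡ m j) ⟩
  s j ∸ removed m j + added m j + removed m j
    ≡⟨ cong (_+ removed m j) (sym (+-∸-comm (added m j) (removed-≤ m j))) ⟩
  (s j + added m j) ∸ removed m j + removed m j
    ≡⟨ m∸n+n≡m (≤-trans (removed-≤ m j) (m≤m+n (s j) (added m j))) ⟩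
  s j + added m j ∎
  where open ≡-Reasoning

apply-bounded : ∀ {B s} → Bounded B s → (m : Move s) → Bounded (suc B) (apply s m)
apply-bounded {B} {s} bounded m j B+1<j = m+n≡0⇒m≡0 _ (begin
  apply s m j + removed m j ≡⟨ apply-+-removed m j ⟩
  s j + added m j           ≡⟨ cong₂ _+_ (bounded j (<-trans (n<1+n B) B+1<j))
                                        (added-vanishes m j (≤-<-trans (s≤s pivot≤B) B+1<j)) ⟩
  0 ∎)
  where
  open ≡-Reasoning
  pivot≤B : pivot m ≤ B
  pivot≤B = occupied-≤ bounded (pivot-occupied m)

record CombiningWeight (e : ℕ) (w : ℕ → ℕ) : Set where
  field
    pair-of-ones : w 2 ≡ 2 * w 1 + e
    recurrence   : ∀ i → w (3 + i) ≡ (2 + i) * w (2 + i) + w (1 + i) + e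

  split-twos : w 1 + w 3 ≡ 3 * w 2
  split-twos = begin
    w 1 + w 3                      ≡⟨ cong (w 1 +_) (recurrence 0) ⟩
    w 1 + (2 * w 2 + w 1 + e)      ≡⟨ regroup (w 1) (w 2) e ⟩
    2 * w 2 + (2 * w 1 + e)        ≡⟨ cong (2 * w 2 +_) (sym pair-of-ones) ⟩
    2 * w 2 + w 2                  ≡⟨ +-comm (2 * w 2) (w 2) ⟩
    3 * w 2 ∎
    where
    open ≡-Reasoning
    regroup : ∀ x y e → x + (2 * y + x + e) ≡ 2 * y + (2 * x + e)
    regroup = solve-∀

  split : ∀ i → w (4 + i) + (1 + i) * w (2 + i) + w (1 + i) ≡ (4 + i) * w (3 + i)
  split i = begin
    w (4 + i) + (1 + i) * w (2 + i) + w (1 + i)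
      ≡⟨ cong (λ x → x + (1 + i) * w (2 + i) + w (1 + i)) (recurrence (suc i)) ⟩
    (3 + i) * w (3 + i) + w (2 + i) + e + (1 + i) * w (2 + i) + w (1 + i)
      ≡⟨ regroup i (w (3 + i)) (w (2 + i)) (w (1 + i)) e ⟩
    (3 + i) * w (3 + i) + ((2 + i) * w (2 + i) + w (1 + i) + e)
      ≡⟨ cong ((3 + i) * w (3 + i) +_) (sym (recurrence i)) ⟩
    (3 + i) * w (3 + i) + w (3 + i)
      ≡⟨ +-comm ((3 + i) * w (3 + i)) (w (3 + i)) ⟩
    (4 + i) * w (3 + i) ∎
    where
    open ≡-Reasoning
    regroup : ∀ i x y z e → (3 + i) * x + y + e + (1 + i) * y + z ≡ (3 + i) * x + ((2 + i) * y + z + e)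
    regroup = solve-∀

a-combiningWeight : CombiningWeight 0 a
a-combiningWeight = record { pair-of-ones = refl ; recurrence = λ i → sym (+-identityʳ _) }

c-combiningWeight : CombiningWeight 1 c
c-combiningWeight = record { pair-of-ones = refl ; recurrence = λ i → refl }

combiningCount : MoveKind → ℕ
combiningCount combining = 1
combiningCount splitting = 0

moves : {s : State} → Game s → ℕ
moves (done _ _)   = 0
moves (step _ _ g) = suc (moves g)

final : {s : State} → Game s → State
final (done s _)   = s
final (step _ _ g) = final g

final-terminal : {s : State} (g : Game s) → ¬ Move (final g)
final-terminal (done _ no-move) = no-move
final-terminal (step _ _ g)     = final-terminal g

combiningMoves-step : ∀ {s} (m : Move s) (g : Game (apply s m)) →
  combiningMoves (step s m g) ≡ combiningCount (kind m) + combiningMoves g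
combiningMoves-step m g with kind m
... | combining = refl
... | splitting = refl

module _ {e w} (cw : CombiningWeight e w) {M : ℕ} where
  open CombiningWeight cw
  open ≡-Reasoning

  combine-ones-weight : 2 ≤ M → weight M w (pt 2 1) ≡ weight M w (pt 1 2) + e
  combine-ones-weight 2≤M = begin
    weight M w (pt 2 1)      ≡⟨ weight-pt-1 1 w 2≤M ⟩
    w 2                      ≡⟨ pair-of-ones ⟩
    2 * w 1 + e              ≡⟨ cong (_+ e) (sym (weight-pt 0 w 2 (<⇒≤ 2≤M))) ⟩
    weight M w (pt 1 2) + e  ∎

  combine-weight : ∀ i → 3 + i ≤ M →
    weight M w (pt (3 + i) 1) ≡ weight M w (λ j → pt (2 + i) (2 + i) j + pt (1 + i) 1 j) + e
  combine-weight i 3+i≤M = begin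
    weight M w (pt (3 + i) 1)
      ≡⟨ weight-pt-1 (2 + i) w 3+i≤M ⟩
    w (3 + i)
      ≡⟨ recurrence i ⟩
    (2 + i) * w (2 + i) + w (1 + i) + e
      ≡⟨ cong (_+ e) (sym (cong₂ _+_ (weight-pt (1 + i) w (2 + i) 2+i≤M) (weight-pt-1 i w 1+i≤M))) ⟩
    weight M w (pt (2 + i) (2 + i)) + weight M w (pt (1 + i) 1) + e
      ≡⟨ cong (_+ e) (sym (weight-+ M w (pt (2 + i) (2 + i)) (pt (1 + i) 1))) ⟩
    weight M w (λ j → pt (2 + i) (2 + i) j + pt (1 + i) 1 j) + e ∎
    where
    2+i≤M : 2 + i ≤ M
    2+i≤M = <⇒≤ 3+i≤M
    1+i≤M : 1 + i ≤ M
    1+i≤M = ≤-trans (n≤1+n (1 + i)) 2+i≤M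

  split-twos-weight : 3 ≤ M → weight M w (λ j → pt 1 1 j + pt 3 1 j) ≡ weight M w (pt 2 3)
  split-twos-weight 3≤M = begin
    weight M w (λ j → pt 1 1 j + pt 3 1 j)
      ≡⟨ weight-+ M w (pt 1 1) (pt 3 1) ⟩
    weight M w (pt 1 1) + weight M w (pt 3 1)
      ≡⟨ cong₂ _+_ (weight-pt-1 0 w (≤-trans (s≤s z≤n) 3≤M)) (weight-pt-1 2 w 3≤M) ⟩
    w 1 + w 3
      ≡⟨ split-twos ⟩
    3 * w 2
      ≡⟨ sym (weight-pt 1 w 3 (<⇒≤ 3≤M)) ⟩
    weight M w (pt 2 3) ∎

  split-weight : ∀ i → 4 + i ≤ M →
    weight M w (λ j → pt (4 + i) 1 j + pt (2 + i) (1 + i) j + pt (1 + i) 1 j) ≡ weight M w (pt (3 + i) (4 + i))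
  split-weight i 4+i≤M = begin
    weight M w (λ j → pt (4 + i) 1 j + pt (2 + i) (1 + i) j + pt (1 + i) 1 j)
      ≡⟨ weight-+ M w (λ j → pt (4 + i) 1 j + pt (2 + i) (1 + i) j) (pt (1 + i) 1) ⟩
    weight M w (λ j → pt (4 + i) 1 j + pt (2 + i) (1 + i) j) + weight M w (pt (1 + i) 1)
      ≡⟨ cong (_+ weight M w (pt (1 + i) 1)) (weight-+ M w (pt (4 + i) 1) (pt (2 + i) (1 + i))) ⟩
    weight M w (pt (4 + i) 1) + weight M w (pt (2 + i) (1 + i)) + weight M w (pt (1 + i) 1)
      ≡⟨ cong₂ _+_ (cong₂ _+_ (weight-pt-1 (3 + i) w 4+i≤M) (weight-pt (1 + i) w (1 + i) 2+i≤M))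
                   (weight-pt-1 i w (≤-trans (n≤1+n (1 + i)) 2+i≤M)) ⟩
    w (4 + i) + (1 + i) * w (2 + i) + w (1 + i)
      ≡⟨ split i ⟩
    (4 + i) * w (3 + i)
      ≡⟨ sym (weight-pt (2 + i) w (4 + i) 3+i≤M) ⟩
    weight M w (pt (3 + i) (4 + i)) ∎
    where
    3+i≤M : 3 + i ≤ M
    3+i≤M = <⇒≤ 4+i≤M
    2+i≤M : 2 + i ≤ M
    2+i≤M = ≤-trans (n≤1+n (2 + i)) 3+i≤M

  added-weight : ∀ {s} (m : Move s) → suc (pivot m) ≤ M →
    weight M w (added m) ≡ weight M w (removed m) + combiningCount (kind m) * e
  added-weight (comb1 _) 2≤M =
    trans (combine-ones-weight 2≤M) (cong (weight M w (pt 1 2) +_) (sym (*-identityˡ e)))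
  added-weight (combi 1 (s≤s ()) _ _) _
  added-weight m@(combi (suc (suc i)) _ _ _) 3+i≤M =
    trans (combine-weight i 3+i≤M) (cong (weight M w (removed m) +_) (sym (*-identityˡ e)))
  added-weight (split2 _) 3≤M = trans (split-twos-weight 3≤M) (sym (+-identityʳ _))
  added-weight (spliti 1 (s≤s ()) _) _
  added-weight (spliti 2 (s≤s (s≤s ())) _) _
  added-weight (spliti (suc (suc (suc i))) _ _) 4+i≤M = trans (split-weight i 4+i≤M) (sym (+-identityʳ _))

  apply-weight : ∀ {B s} (m : Move s) → Bounded B s → suc B ≤ M →
    weight M w (apply s m) ≡ weight M w s + combiningCount (kind m) * e
  apply-weight {B} {s} m bounded B<M = +-cancelʳ-≡ (weight M w (removed m)) _ _ (begin
    weight M w (apply s m) + weight M w (removed m)  ≡⟨ sym (weight-+ M w (apply s m) (removed m)) ⟩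
    weight M w (λ j → apply s m j + removed m j)     ≡⟨ weight-cong M w (apply-+-removed m) ⟩
    weight M w (λ j → s j + added m j)               ≡⟨ weight-+ M w s (added m) ⟩
    weight M w s + weight M w (added m)              ≡⟨ cong (weight M w s +_) (added-weight m pivot<M) ⟩
    weight M w s + (weight M w (removed m) + combiningCount (kind m) * e)
      ≡⟨ x∙yz≈xz∙y (weight M w s) (weight M w (removed m)) (combiningCount (kind m) * e) ⟩
    weight M w s + combiningCount (kind m) * e + weight M w (removed m) ∎)
    where
    pivot<M : suc (pivot m) ≤ M
    pivot<M = ≤-trans (s≤s (occupied-≤ bounded (pivot-occupied m))) B<M

  -- Each move occupies at most one new index above the current ones, so a window of
  -- length B + moves g sees the whole game.
  game-weight : ∀ {B s} (g : Game s) → Bounded B s → B + moves g ≤ M →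
    weight M w (final g) ≡ weight M w s + combiningMoves g * e
  game-weight (done _ _) _ _ = sym (+-identityʳ _)
  game-weight {B} (step s m g) bounded B+moves≤M = begin
    weight M w (final g)
      ≡⟨ game-weight g (apply-bounded bounded m) B+1+moves≤M ⟩
    weight M w (apply s m) + combiningMoves g * e
      ≡⟨ cong (_+ combiningMoves g * e) (apply-weight m bounded (≤-trans (m≤m+n (suc B) (moves g)) B+1+moves≤M)) ⟩
    weight M w s + combiningCount (kind m) * e + combiningMoves g * e
      ≡⟨ +-assoc (weight M w s) _ _ ⟩
    weight M w s + (combiningCount (kind m) * e + combiningMoves g * e)
      ≡⟨ cong (weight M w s +_) (sym (*-distribʳ-+ e (combiningCount (kind m)) (combiningMoves g))) ⟩
    weight M w s + (combiningCount (kind m) + combiningMoves g) * e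
      ≡⟨ cong (λ k → weight M w s + k * e) (sym (combiningMoves-step m g)) ⟩
    weight M w s + combiningMoves (step s m g) * e ∎
    where
    B+1+moves≤M : suc B + moves g ≤ M
    B+1+moves≤M = subst (_≤ M) (+-suc B (moves g)) B+moves≤M

initial-bounded : ∀ n → Bounded 1 (initial n)
initial-bounded n j 1<j = pt-> n 1<j

weight-initial : ∀ M w n → weight (suc M) w (initial n) ≡ n * w 1
weight-initial M w n = weight-pt {suc M} 0 w n (s≤s z≤n)

record LegalDigits (k : ℕ) (δ : ℕ → ℕ) : Set where
  field
    digit≤    : ∀ i → 1 ≤ i → i ≤ k → δ i ≤ i
    full⇒zero : ∀ i → 2 ≤ i → i ≤ k → δ i ≡ i → δ (i ∸ 1) ≡ 0

LegalDigits-mono : ∀ {k l δ} → l ≤ k → LegalDigits k δ → LegalDigits l δ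
LegalDigits-mono l≤k legal = record
  { digit≤    = λ i 1≤i i≤l → digit≤ i 1≤i (≤-trans i≤l l≤k)
  ; full⇒zero = λ i 2≤i i≤l → full⇒zero i 2≤i (≤-trans i≤l l≤k)
  }
  where open LegalDigits legal

terminal⇒legal : ∀ {s} → ¬ Move s → ∀ k → LegalDigits k s
terminal⇒legal {s} no-move k = record { digit≤ = digit≤ ; full⇒zero = full⇒zero }
  where
  digit≤ : ∀ i → 1 ≤ i → i ≤ k → s i ≤ i
  digit≤ i _ _ with s i ≤? i
  ... | yes sᵢ≤i = sᵢ≤i
  digit≤ 1 _ _ | no sᵢ≰i = contradiction (comb1 (≰⇒> sᵢ≰i)) no-move
  digit≤ 2 _ _ | no sᵢ≰i = contradiction (split2 (≰⇒> sᵢ≰i)) no-move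
  digit≤ (suc (suc (suc i))) _ _ | no sᵢ≰i =
    contradiction (spliti _ (s≤s (s≤s (s≤s z≤n))) (≰⇒> sᵢ≰i)) no-move
  full⇒zero : ∀ i → 2 ≤ i → i ≤ k → s i ≡ i → s (i ∸ 1) ≡ 0
  full⇒zero i 2≤i _ sᵢ≡i with s (i ∸ 1) ≟ 0
  ... | yes sᵢ₋₁≡0 = sᵢ₋₁≡0
  ... | no sᵢ₋₁≢0  = contradiction (combi i 2≤i (≤-reflexive (sym sᵢ≡i)) (n≢0⇒n>0 sᵢ₋₁≢0)) no-move

a-step : ∀ i → a i ≤ a (suc i)
a-step 0             = z≤n
a-step 1             = s≤s z≤n
a-step (suc (suc i)) = ≤-trans (m≤m+n (a (2 + i)) _) (m≤m+n _ (a (1 + i)))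

a-mono : ∀ {i j} → i ≤ j → a i ≤ a j
a-mono {j = zero} z≤n = ≤-refl
a-mono {i} {suc j} i≤1+j with m≤n⇒m<n∨m≡n i≤1+j
... | inj₁ i<1+j = ≤-trans (a-mono (s≤s⁻¹ i<1+j)) (a-step j)
... | inj₂ refl  = ≤-refl

a-positive : ∀ i → 0 < a (suc i)
a-positive i = a-mono {1} {suc i} (s≤s z≤n)

weight-top-zero : ∀ k w (δ : State) → δ (suc k) ≡ 0 → weight (suc k) w δ ≡ weight k w δ
weight-top-zero k w δ δₖ≡0 = trans (cong (λ x → weight k w δ + x * w (suc k)) δₖ≡0) (+-identityʳ _)

weight-a-zero : ∀ m w (ε : State) → weight m a ε ≡ 0 → weight m w ε ≡ 0
weight-a-zero zero    w ε _ = refl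
weight-a-zero (suc m) w ε weight≡0 =
  cong₂ _+_ (weight-a-zero m w ε (m+n≡0⇒m≡0 _ weight≡0)) (cong (_* w (suc m)) εₘ≡0)
  where
  εₘ≡0 : ε (suc m) ≡ 0
  εₘ≡0 = m*n≡0⇒m≡0 (ε (suc m)) (a (suc m)) {{>-nonZero (a-positive m)}}
           (m+n≡0⇒n≡0 (weight m a ε) weight≡0)

legal-weight-< : ∀ {k δ} → LegalDigits k δ → weight k a δ < a (suc k)
legal-weight-< {zero} _ = z<s
legal-weight-< {suc zero} {δ} legal =
  s≤s (subst (_≤ 1) (sym (*-identityʳ (δ 1))) (LegalDigits.digit≤ legal 1 ≤-refl ≤-refl))
legal-weight-< {suc (suc k)} {δ} legal
  with legal-weight-< {k} (LegalDigits-mono (≤-trans (n≤1+n k) (n≤1+n (1 + k))) legal)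
     | legal-weight-< {suc k} (LegalDigits-mono (n≤1+n (1 + k)) legal)
     | δ (2 + k) ≟ 2 + k
... | below₀ | _ | yes full = begin-strict
  weight (suc k) a δ + δ (2 + k) * a (2 + k)
    ≡⟨ cong₂ _+_ (weight-top-zero k a δ δₖ₋₁≡0) (cong (_* a (2 + k)) full) ⟩
  weight k a δ + (2 + k) * a (2 + k)
    <⟨ +-monoˡ-< _ below₀ ⟩
  a (1 + k) + (2 + k) * a (2 + k)
    ≡⟨ +-comm (a (1 + k)) _ ⟩
  a (3 + k) ∎
  where
  open ≤-Reasoning
  δₖ₋₁≡0 : δ (1 + k) ≡ 0
  δₖ₋₁≡0 = LegalDigits.full⇒zero legal (2 + k) (s≤s (s≤s z≤n)) ≤-refl full
... | _ | below₁ | no not-full = begin-strict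
  weight (suc k) a δ + δ (2 + k) * a (2 + k)
    <⟨ +-monoˡ-< _ below₁ ⟩
  a (2 + k) + δ (2 + k) * a (2 + k)
    ≤⟨ +-monoʳ-≤ (a (2 + k)) (*-monoˡ-≤ (a (2 + k)) δₖ≤1+k) ⟩
  a (2 + k) + (1 + k) * a (2 + k)
    ≤⟨ m≤m+n _ (a (1 + k)) ⟩
  a (3 + k) ∎
  where
  open ≤-Reasoning
  δₖ≤1+k : δ (2 + k) ≤ 1 + k
  δₖ≤1+k = s≤s⁻¹ (≤∧≢⇒< (LegalDigits.digit≤ legal (2 + k) (s≤s z≤n) ≤-refl) not-full)

legal-weight-<-longer : ∀ {k m δ ε} → LegalDigits k δ → k ≤ m → 1 ≤ ε (suc m) →
  weight k a δ < weight (suc m) a ε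
legal-weight-<-longer {k} {m} {δ} {ε} legal k≤m 1≤εₘ = begin-strict
  weight k a δ             <⟨ legal-weight-< legal ⟩
  a (suc k)                ≤⟨ a-mono (s≤s k≤m) ⟩
  a (suc m)                ≤⟨ m≤n*m (a (suc m)) (ε (suc m)) {{>-nonZero 1≤εₘ}} ⟩
  ε (suc m) * a (suc m)    ≤⟨ m≤n+m _ (weight m a ε) ⟩
  weight (suc m) a ε ∎
  where open ≤-Reasoning

legal-weight-<-top : ∀ {k δ ε} → LegalDigits (suc k) δ → δ (suc k) < ε (suc k) →
  weight (suc k) a δ < weight (suc k) a ε
legal-weight-<-top {k} {δ} {ε} legal δₖ<εₖ = begin-strict
  weight k a δ + δ (suc k) * a (suc k)    <⟨ +-monoˡ-< _ (legal-weight-< (LegalDigits-mono (n≤1+n k) legal)) ⟩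
  a (suc k) + δ (suc k) * a (suc k)       ≤⟨ *-monoˡ-≤ (a (suc k)) δₖ<εₖ ⟩
  ε (suc k) * a (suc k)                   ≤⟨ m≤n+m _ (weight k a ε) ⟩
  weight (suc k) a ε ∎
  where open ≤-Reasoning

-- Stated for every weight w because δ and ε are only constrained on their own windows.
legal-unique : ∀ {k m δ ε} → LegalDigits k δ → LegalDigits m ε → weight k a δ ≡ weight m a ε →
  ∀ w → weight k w δ ≡ weight m w ε
legal-unique {zero}  {m} {ε = ε} _ _ same w = sym (weight-a-zero m w ε (sym same))
legal-unique {suc k} {zero} {δ} _ _ same w = weight-a-zero (suc k) w δ same
legal-unique {suc k} {suc m} {δ} {ε} legalδ legalε same w with δ (suc k) ≟ 0 | ε (suc m) ≟ 0
... | yes δₖ≡0 | _ = trans (weight-top-zero k w δ δₖ≡0)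
  (legal-unique (LegalDigits-mono (n≤1+n k) legalδ) legalε (trans (sym (weight-top-zero k a δ δₖ≡0)) same) w)
... | no _ | yes εₘ≡0 = trans
  (legal-unique legalδ (LegalDigits-mono (n≤1+n m) legalε) (trans same (weight-top-zero m a ε εₘ≡0)) w)
  (sym (weight-top-zero m w ε εₘ≡0))
... | no δₖ≢0 | no εₘ≢0 with <-cmp k m
...   | tri< k<m _ _ = contradiction same (<⇒≢ (legal-weight-<-longer {ε = ε} legalδ k<m (n≢0⇒n>0 εₘ≢0)))
...   | tri> _ _ m<k = contradiction (sym same) (<⇒≢ (legal-weight-<-longer {ε = δ} legalε m<k (n≢0⇒n>0 δₖ≢0)))
...   | tri≈ _ refl _ with <-cmp (δ (suc k)) (ε (suc k))
...     | tri< δₖ<εₖ _ _ = contradiction same (<⇒≢ (legal-weight-<-top {ε = ε} legalδ δₖ<εₖ))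
...     | tri> _ _ εₖ<δₖ = contradiction (sym same) (<⇒≢ (legal-weight-<-top {ε = δ} legalε εₖ<δₖ))
...     | tri≈ _ δₖ≡εₖ _ = cong₂ _+_
  (legal-unique (LegalDigits-mono (n≤1+n k) legalδ) (LegalDigits-mono (n≤1+n k) legalε)
    (+-cancelʳ-≡ (δ (suc k) * a (suc k)) _ _
      (trans same (cong (λ x → weight k a ε + x * a (suc k)) (sym δₖ≡εₖ)))) w)
  (cong (_* w (suc k)) δₖ≡εₖ)

theorem6p8 : (n : ℕ) → 1 ≤ n → (k : ℕ) → (δ : ℕ → ℕ) → Legal n k δ →
    (g : Game (initial n)) → combiningMoves g ≡ sum1to k (λ i → δ i * c i)
theorem6p8 n _ k δ (digit≤ , full⇒zero , n≡) g = begin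
  combiningMoves g                               ≡⟨ sym (*-identityʳ _) ⟩
  combiningMoves g * 1                           ≡⟨ cong (_+ combiningMoves g * 1) (sym initial-c) ⟩
  weight M c (initial n) + combiningMoves g * 1  ≡⟨ sym (game-weight c-combiningWeight g (initial-bounded n) ≤-refl) ⟩
  weight M c (final g)                           ≡⟨ sym (legal-unique δ-legal final-legal same-value c) ⟩
  weight k c δ                                   ∎
  where
  open ≡-Reasoning
  M : ℕ
  M = suc (moves g)
  δ-legal : LegalDigits k δ
  δ-legal = record { digit≤ = digit≤ ; full⇒zero = full⇒zero }
  final-legal : LegalDigits M (final g)
  final-legal = terminal⇒legal (final-terminal g) M
  initial-c : weight M c (initial n) ≡ 0
  initial-c = trans (weight-initial (moves g) c n) (*-zeroʳ n)
  same-value : weight k a δ ≡ weight M a (final g)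
  same-value = begin
    weight k a δ                                   ≡⟨ sym n≡ ⟩
    n                                              ≡⟨ sym (trans (weight-initial (moves g) a n) (*-identityʳ n)) ⟩
    weight M a (initial n)                         ≡⟨ sym (trans (cong (weight M a (initial n) +_) (*-zeroʳ (combiningMoves g))) (+-identityʳ _)) ⟩
    weight M a (initial n) + combiningMoves g * 0  ≡⟨ sym (game-weight a-combiningWeight g (initial-bounded n) ≤-refl) ⟩
    weight M a (final g)                           ∎
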